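{- Fix $k\in\mathbb Z_{\ge0}$. Let $(P,Q,R)$ be a $k$-GC triple and let $(X,Y,Z)$ be an MM decomposition of $(P,Q,R)$. Then $(X,Z,Z^{ -1}YZ)$ is an MM decomposition of $(P,PQ-S,Q)$, and $(XYX^{ -1},X,Z)$ is an MM decomposition of $(Q,QR-S,R)$.
   Context: Fix $k\in\mathbb Z_{\ge0}$. A $k$-GM triple is $(a,b,c)\in\mathbb Z_{\ge1}^3$ with $a^2+b^2+c^2+k(bc+ca+ab)=(3+3k)abc$; a $k$-GM number is an entry of some $k$-GM triple. Let $S=\begin{bmatrix}k&0\\3k^2+3k&k\end{bmatrix}$. A $k$-GC matrix is $P\in SL(2,\mathbb Z)$ whose $(1,2)$-entry $p_{12}$ is a $k$-GM number and $\operatorname{tr}P=(3k+3)p_{12}-k$; a $k$-GC triple is a triple $(P,Q,R)$ of $k$-GC matrices with $Q=PR-S$ and $(p_{12},q_{12},r_{12})$ a $k$-GM triple. (If $(P,Q,R)$ is a $k$-GC triple then so are $(P,PQ-S,Q)$ and $(Q,QR-S,R)$.) An MM decomposition of a $k$-GC triple $(P,Q,R)$ is a triple $(X,Y,Z)$ with $X,Y,Z\in SL(2,\mathbb Z)$, $P=-Z^{ -1}Y^{ -1}$, $Q=-Z^{ -1}X^{ -1}$, $R=-Y^{ -1}X^{ -1}$, and $\operatorname{tr}X=\operatorname{tr}Y=\operatorname{tr}Z$. -}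

module Defs where

open import Data.Integer using (ℤ; +_; _+_; _-_; _*_; -_)
open import Data.Nat using (ℕ)
open import Data.Product using (_×_; Σ; ∃)
open import Data.Sum using (_⊎_)
open import Relation.Binary.PropositionalEquality using (_≡_)

record M2 : Set where
  constructor mat
  field
    a11 a12 a21 a22 : ℤ
open M2 public

_·_ : M2 → M2 → M2
mat a b c d · mat e f g h = mat (a * e + b * g) (a * f + b * h) (c * e + d * g) (c * f + d * h)
infixl 7 _·_

_⊖_ : M2 → M2 → M2
mat a b c d ⊖ mat e f g h = mat (a - e) (b - f) (c - g) (d - h)
infixl 6 _⊖_

neg : M2 → M2
neg (mat a b c d) = mat (- a) (- b) (- c) (- d)

det : M2 → ℤ
det (mat a b c d) = a * d - b * c

tr : M2 → ℤ
tr (mat a b c d) = a + d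

IsSL2 : M2 → Set
IsSL2 A = det A ≡ + 1

-- inverse of a matrix of determinant 1 (the adjugate); for A ∈ SL(2,ℤ) this is A⁻¹
inv : M2 → M2
inv (mat a b c d) = mat d (- b) (- c) a

IsGMTriple : ℕ → ℕ → ℕ → ℕ → Set
IsGMTriple k a b c =
  (1 Data.Nat.≤ a) × (1 Data.Nat.≤ b) × (1 Data.Nat.≤ c) ×
  (a Data.Nat.* a Data.Nat.+ b Data.Nat.* b Data.Nat.+ c Data.Nat.* c
     Data.Nat.+ k Data.Nat.* (b Data.Nat.* c Data.Nat.+ c Data.Nat.* a Data.Nat.+ a Data.Nat.* b)
   ≡ (3 Data.Nat.+ 3 Data.Nat.* k) Data.Nat.* (a Data.Nat.* b Data.Nat.* c))

IsGMNumber : ℕ → ℤ → Set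
IsGMNumber k x = Σ ℕ λ a → (x ≡ + a) × ∃ λ b → ∃ λ c →
  IsGMTriple k a b c ⊎ IsGMTriple k b a c ⊎ IsGMTriple k b c a

Smat : ℕ → M2
Smat k = mat (+ k) (+ 0) (+ (3 Data.Nat.* k Data.Nat.* k Data.Nat.+ 3 Data.Nat.* k)) (+ k)

IsGCMatrix : ℕ → M2 → Set
IsGCMatrix k P = IsSL2 P × IsGMNumber k (a12 P) ×
  (tr P ≡ (+ (3 Data.Nat.* k Data.Nat.+ 3)) * a12 P - + k)

IsGCTriple : ℕ → M2 → M2 → M2 → Set
IsGCTriple k P Q R = IsGCMatrix k P × IsGCMatrix k Q × IsGCMatrix k R ×
  (Q ≡ P · R ⊖ Smat k) ×
  Σ ℕ λ p → Σ ℕ λ q → Σ ℕ λ r →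
    (a12 P ≡ + p) × (a12 Q ≡ + q) × (a12 R ≡ + r) × IsGMTriple k p q r

IsMMDecomposition : M2 → M2 → M2 → M2 → M2 → M2 → Set
IsMMDecomposition P Q R X Y Z =
  IsSL2 X × IsSL2 Y × IsSL2 Z ×
  (P ≡ neg (inv Z · inv Y)) × (Q ≡ neg (inv Z · inv X)) × (R ≡ neg (inv Y · inv X)) ×
  (tr X ≡ tr Y) × (tr Y ≡ tr Z)

-- For 2×2 matrices
-- Cayley–Hamilton says A⁻¹ = (tr A)I − A, so the equal traces give Q − R = (Y⁻¹ − Z⁻¹)X⁻¹ = (Z − Y)X⁻¹
-- and Q − P = Z⁻¹(Y⁻¹ − X⁻¹) = Z⁻¹(X − Y). Expanding with Y⁻¹Y = YY⁻¹ = I leaves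
-- PQ − S = −Z⁻¹Y⁻¹ZX⁻¹ = −(Z⁻¹YZ)⁻¹X⁻¹ and QR − S = −Z⁻¹XY⁻¹X⁻¹ = −Z⁻¹(XYX⁻¹)⁻¹; the other
-- conditions hold because conjugation preserves determinant and trace.
module Submission where

open import Defs
open import Data.Integer using (ℤ; +_; _+_; _-_; _*_; -_)
open import Data.Integer.Properties using (neg-involutive)
open import Data.Integer.Tactic.RingSolver using (solve-∀)
open import Data.Nat using (ℕ)
open import Data.Product using (_×_; _,_)
open import Relation.Binary.PropositionalEquality using (_≡_; refl; sym; trans; cong; cong₂; subst; module ≡-Reasoning)

open ≡-Reasoning

_⊕_ : M2 → M2 → M2
mat a b c d ⊕ mat e f g h = mat (a + e) (b + f) (c + g) (d + h)
infixl 6 _⊕_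

scalar : ℤ → M2
scalar t = mat t (+ 0) (+ 0) t

I : M2
I = scalar (+ 1)

mat-≡ : ∀ {a b c d e f g h : ℤ} → a ≡ e → b ≡ f → c ≡ g → d ≡ h → mat a b c d ≡ mat e f g h
mat-≡ refl refl refl refl = refl

·-assoc : ∀ A B C → A · B · C ≡ A · (B · C)
·-assoc (mat a b c d) (mat e f g h) (mat i j k l) =
  mat-≡ (entry a b e f g h i k) (entry a b e f g h j l) (entry c d e f g h i k) (entry c d e f g h j l)
  where
  entry : ∀ a b e f g h i k → (a * e + b * g) * i + (a * f + b * h) * k ≡ a * (e * i + f * k) + b * (g * i + h * k)
  entry = solve-∀

·-identityˡ : ∀ A → I · A ≡ A
·-identityˡ (mat a b c d) = mat-≡ (first a c) (first b d) (second a c) (second b d)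
  where
  first : ∀ a c → + 1 * a + + 0 * c ≡ a
  first = solve-∀
  second : ∀ a c → + 0 * a + + 1 * c ≡ c
  second = solve-∀

·-identityʳ : ∀ A → A · I ≡ A
·-identityʳ (mat a b c d) = mat-≡ (first a b) (second a b) (first c d) (second c d)
  where
  first : ∀ a b → a * + 1 + b * + 0 ≡ a
  first = solve-∀
  second : ∀ a b → a * + 0 + b * + 1 ≡ b
  second = solve-∀

·-distribˡ-⊖ : ∀ A B C → A · (B ⊖ C) ≡ A · B ⊖ A · C
·-distribˡ-⊖ (mat a b c d) (mat e f g h) (mat i j k l) =
  mat-≡ (entry a b e g i k) (entry a b f h j l) (entry c d e g i k) (entry c d f h j l)
  where
  entry : ∀ a b e g i k → a * (e - i) + b * (g - k) ≡ (a * e + b * g) - (a * i + b * k)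
  entry = solve-∀

·-distribʳ-⊖ : ∀ A B C → (A ⊖ B) · C ≡ A · C ⊖ B · C
·-distribʳ-⊖ (mat a b c d) (mat e f g h) (mat i j k l) =
  mat-≡ (entry a b e f i k) (entry a b e f j l) (entry c d g h i k) (entry c d g h j l)
  where
  entry : ∀ a b e f i k → (a - e) * i + (b - f) * k ≡ (a * i + b * k) - (e * i + f * k)
  entry = solve-∀

neg-distribˡ-· : ∀ A B → neg (A · B) ≡ neg A · B
neg-distribˡ-· (mat a b c d) (mat e f g h) =
  mat-≡ (entry a b e g) (entry a b f h) (entry c d e g) (entry c d f h)
  where
  entry : ∀ a b e g → - (a * e + b * g) ≡ - a * e + - b * g
  entry = solve-∀

neg-distribʳ-· : ∀ A B → neg (A · B) ≡ A · neg B
neg-distribʳ-· (mat a b c d) (mat e f g h) =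
  mat-≡ (entry a b e g) (entry a b f h) (entry c d e g) (entry c d f h)
  where
  entry : ∀ a b e g → - (a * e + b * g) ≡ a * - e + b * - g
  entry = solve-∀

neg-⊖-neg : ∀ A B → neg A ⊖ neg B ≡ B ⊖ A
neg-⊖-neg (mat a b c d) (mat e f g h) = mat-≡ (entry a e) (entry b f) (entry c g) (entry d h)
  where
  entry : ∀ a e → - a - - e ≡ e - a
  entry = solve-∀

⊖-⊕-⊖ : ∀ A B C → A ⊖ B ⊕ (B ⊖ C) ≡ A ⊖ C
⊖-⊕-⊖ (mat a b c d) (mat e f g h) (mat i j k l) =
  mat-≡ (entry a e i) (entry b f j) (entry c g k) (entry d h l)
  where
  entry : ∀ a e i → a - e + (e - i) ≡ a - i
  entry = solve-∀

neg-⊖-⊕-neg : ∀ A B → neg (A ⊖ B) ⊕ neg B ≡ neg A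
neg-⊖-⊕-neg (mat a b c d) (mat e f g h) = mat-≡ (entry a e) (entry b f) (entry c g) (entry d h)
  where
  entry : ∀ a e → - (a - e) + - e ≡ - a
  entry = solve-∀

det-· : ∀ A B → det (A · B) ≡ det A * det B
det-· (mat a b c d) (mat e f g h) = expand a b c d e f g h
  where
  expand : ∀ a b c d e f g h →
    (a * e + b * g) * (c * f + d * h) - (a * f + b * h) * (c * e + d * g) ≡ (a * d - b * c) * (e * h - f * g)
  expand = solve-∀

det-inv : ∀ A → det (inv A) ≡ det A
det-inv (mat a b c d) = expand a b c d
  where
  expand : ∀ a b c d → d * a - - b * - c ≡ a * d - b * c
  expand = solve-∀

tr-comm : ∀ A B → tr (A · B) ≡ tr (B · A)
tr-comm (mat a b c d) (mat e f g h) = expand a b c d e f g h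
  where
  expand : ∀ a b c d e f g h → a * e + b * g + (c * f + d * h) ≡ e * a + f * c + (g * b + h * d)
  expand = solve-∀

inv-involutive : ∀ A → inv (inv A) ≡ A
inv-involutive (mat a b c d) = mat-≡ refl (neg-involutive b) (neg-involutive c) refl

inv-anti-homo-· : ∀ A B → inv (A · B) ≡ inv B · inv A
inv-anti-homo-· (mat a b c d) (mat e f g h) =
  mat-≡ (entry₁₁ c d f h) (entry₁₂ a b f h) (entry₂₁ c d e g) (entry₂₂ a b e g)
  where
  entry₁₁ : ∀ c d f h → c * f + d * h ≡ h * d + - f * - c
  entry₁₁ = solve-∀
  entry₁₂ : ∀ a b f h → - (a * f + b * h) ≡ h * - b + - f * a
  entry₁₂ = solve-∀
  entry₂₁ : ∀ c d e g → - (c * e + d * g) ≡ - g * d + e * - c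
  entry₂₁ = solve-∀
  entry₂₂ : ∀ a b e g → a * e + b * g ≡ - g * - b + e * a
  entry₂₂ = solve-∀

·-inv : ∀ A → A · inv A ≡ scalar (det A)
·-inv (mat a b c d) = mat-≡ (entry₁₁ a b c d) (entry₁₂ a b) (entry₂₁ c d) (entry₂₂ a b c d)
  where
  entry₁₁ : ∀ a b c d → a * d + b * - c ≡ a * d - b * c
  entry₁₁ = solve-∀
  entry₁₂ : ∀ a b → a * - b + b * a ≡ + 0
  entry₁₂ = solve-∀
  entry₂₁ : ∀ c d → c * d + d * - c ≡ + 0
  entry₂₁ = solve-∀
  entry₂₂ : ∀ a b c d → c * - b + d * a ≡ a * d - b * c
  entry₂₂ = solve-∀

cayley-hamilton : ∀ A → inv A ≡ scalar (tr A) ⊖ A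
cayley-hamilton (mat a b c d) = mat-≡ (entry₁₁ a d) (off-diagonal b) (off-diagonal c) (entry₂₂ a d)
  where
  entry₁₁ : ∀ a d → d ≡ a + d - a
  entry₁₁ = solve-∀
  off-diagonal : ∀ b → - b ≡ + 0 - b
  off-diagonal = solve-∀
  entry₂₂ : ∀ a d → a ≡ a + d - d
  entry₂₂ = solve-∀

IsSL2-· : ∀ A B → IsSL2 A → IsSL2 B → IsSL2 (A · B)
IsSL2-· A B detA≡1 detB≡1 = trans (det-· A B) (cong₂ _*_ detA≡1 detB≡1)

IsSL2-inv : ∀ A → IsSL2 A → IsSL2 (inv A)
IsSL2-inv A detA≡1 = trans (det-inv A) detA≡1

·-inverseʳ : ∀ A → IsSL2 A → A · inv A ≡ I
·-inverseʳ A detA≡1 = trans (·-inv A) (cong scalar detA≡1)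

·-inverseˡ : ∀ A → IsSL2 A → inv A · A ≡ I
·-inverseˡ A detA≡1 =
  subst (λ M → inv A · M ≡ I) (inv-involutive A) (·-inverseʳ (inv A) (IsSL2-inv A detA≡1))

B·C≡I⇒A·B·C≡A : ∀ A B C → B · C ≡ I → A · B · C ≡ A
B·C≡I⇒A·B·C≡A A B C B·C≡I = begin
  A · B · C    ≡⟨ ·-assoc A B C ⟩
  A · (B · C)  ≡⟨ cong (A ·_) B·C≡I ⟩
  A · I        ≡⟨ ·-identityʳ A ⟩
  A            ∎

A·B≡I⇒A·[B·C]≡C : ∀ A B C → A · B ≡ I → A · (B · C) ≡ C
A·B≡I⇒A·[B·C]≡C A B C A·B≡I = begin
  A · (B · C)  ≡⟨ ·-assoc A B C ⟨
  A · B · C    ≡⟨ cong (_· C) A·B≡I ⟩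
  I · C        ≡⟨ ·-identityˡ C ⟩
  C            ∎

inv-conjugate : ∀ A B → inv (inv A · B · A) ≡ inv A · inv B · A
inv-conjugate A B = begin
  inv (inv A · B · A)              ≡⟨ inv-anti-homo-· (inv A · B) A ⟩
  inv A · inv (inv A · B)          ≡⟨ cong (inv A ·_) (inv-anti-homo-· (inv A) B) ⟩
  inv A · (inv B · inv (inv A))    ≡⟨ cong (λ M → inv A · (inv B · M)) (inv-involutive A) ⟩
  inv A · (inv B · A)              ≡⟨ ·-assoc (inv A) (inv B) A ⟨
  inv A · inv B · A                ∎

inv-conjugate′ : ∀ A B → inv (A · B · inv A) ≡ A · (inv B · inv A)
inv-conjugate′ A B = begin
  inv (A · B · inv A)              ≡⟨ inv-anti-homo-· (A · B) (inv A) ⟩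
  inv (inv A) · inv (A · B)        ≡⟨ cong₂ _·_ (inv-involutive A) (inv-anti-homo-· A B) ⟩
  A · (inv B · inv A)              ∎

tr-conjugate : ∀ A B → IsSL2 A → tr (inv A · B · A) ≡ tr B
tr-conjugate A B detA≡1 = begin
  tr (inv A · B · A)    ≡⟨ tr-comm (inv A · B) A ⟩
  tr (A · (inv A · B))  ≡⟨ cong tr (A·B≡I⇒A·[B·C]≡C A (inv A) B (·-inverseʳ A detA≡1)) ⟩
  tr B                  ∎

tr-conjugate′ : ∀ A B → IsSL2 A → tr (A · B · inv A) ≡ tr B
tr-conjugate′ A B detA≡1 = begin
  tr (A · B · inv A)    ≡⟨ tr-comm (A · B) (inv A) ⟩
  tr (inv A · (A · B))  ≡⟨ cong tr (A·B≡I⇒A·[B·C]≡C (inv A) A B (·-inverseˡ A detA≡1)) ⟩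
  tr B                  ∎

inv-⊖-inv : ∀ A B → tr A ≡ tr B → inv A ⊖ inv B ≡ B ⊖ A
inv-⊖-inv A B trA≡trB = begin
  inv A ⊖ inv B                               ≡⟨ cong₂ _⊖_ (cayley-hamilton A) (cayley-hamilton B) ⟩
  (scalar (tr A) ⊖ A) ⊖ (scalar (tr B) ⊖ B)   ≡⟨ cong (λ t → (scalar t ⊖ A) ⊖ (scalar (tr B) ⊖ B)) trA≡trB ⟩
  (scalar (tr B) ⊖ A) ⊖ (scalar (tr B) ⊖ B)   ≡⟨ scalar-⊖-⊖ (tr B) A B ⟩
  B ⊖ A                                       ∎
  where
  scalar-⊖-⊖ : ∀ t A B → (scalar t ⊖ A) ⊖ (scalar t ⊖ B) ≡ B ⊖ A
  scalar-⊖-⊖ t (mat a b c d) (mat e f g h) = mat-≡ (entry t a e) (entry (+ 0) b f) (entry (+ 0) c g) (entry t d h)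
    where
    entry : ∀ t a e → t - a - (t - e) ≡ e - a
    entry = solve-∀

P·Q⊖S≡P·[Q⊖R]⊕Q : ∀ P Q R S → Q ≡ P · R ⊖ S → P · Q ⊖ S ≡ P · (Q ⊖ R) ⊕ Q
P·Q⊖S≡P·[Q⊖R]⊕Q P Q R S Q≡PR⊖S = begin
  P · Q ⊖ S                      ≡⟨ ⊖-⊕-⊖ (P · Q) (P · R) S ⟨
  P · Q ⊖ P · R ⊕ (P · R ⊖ S)    ≡⟨ cong₂ _⊕_ (·-distribˡ-⊖ P Q R) Q≡PR⊖S ⟨
  P · (Q ⊖ R) ⊕ Q                ∎

Q·R⊖S≡[Q⊖P]·R⊕Q : ∀ P Q R S → Q ≡ P · R ⊖ S → Q · R ⊖ S ≡ (Q ⊖ P) · R ⊕ Q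
Q·R⊖S≡[Q⊖P]·R⊕Q P Q R S Q≡PR⊖S = begin
  Q · R ⊖ S                      ≡⟨ ⊖-⊕-⊖ (Q · R) (P · R) S ⟨
  Q · R ⊖ P · R ⊕ (P · R ⊖ S)    ≡⟨ cong₂ _⊕_ (·-distribʳ-⊖ Q P R) Q≡PR⊖S ⟨
  (Q ⊖ P) · R ⊕ Q                ∎

MM-P·[Q⊖R]⊕Q : ∀ P Q R X Y Z → IsMMDecomposition P Q R X Y Z →
  P · (Q ⊖ R) ⊕ Q ≡ neg (inv Z · inv Y · Z · inv X)
MM-P·[Q⊖R]⊕Q P Q R X Y Z (_ , detY≡1 , _ , refl , refl , refl , _ , trY≡trZ) = begin
  P · (Q ⊖ R) ⊕ Q                                       ≡⟨ cong (λ M → P · M ⊕ Q) Q⊖R≡ ⟩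
  P · ((Z ⊖ Y) · inv X) ⊕ Q                             ≡⟨ cong (_⊕ Q) P·[Z⊖Y]·X⁻¹≡ ⟩
  neg (inv Z · inv Y · Z · inv X ⊖ inv Z · inv X) ⊕ Q   ≡⟨ neg-⊖-⊕-neg (inv Z · inv Y · Z · inv X) (inv Z · inv X) ⟩
  neg (inv Z · inv Y · Z · inv X)                       ∎
  where
  Q⊖R≡ : Q ⊖ R ≡ (Z ⊖ Y) · inv X
  Q⊖R≡ = begin
    neg (inv Z · inv X) ⊖ neg (inv Y · inv X)  ≡⟨ neg-⊖-neg (inv Z · inv X) (inv Y · inv X) ⟩
    inv Y · inv X ⊖ inv Z · inv X              ≡⟨ ·-distribʳ-⊖ (inv Y) (inv Z) (inv X) ⟨
    (inv Y ⊖ inv Z) · inv X                    ≡⟨ cong (_· inv X) (inv-⊖-inv Y Z trY≡trZ) ⟩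
    (Z ⊖ Y) · inv X                            ∎

  P·[Z⊖Y]·X⁻¹≡ : P · ((Z ⊖ Y) · inv X) ≡ neg (inv Z · inv Y · Z · inv X ⊖ inv Z · inv X)
  P·[Z⊖Y]·X⁻¹≡ = begin
    neg (inv Z · inv Y) · ((Z ⊖ Y) · inv X)
      ≡⟨ neg-distribˡ-· (inv Z · inv Y) ((Z ⊖ Y) · inv X) ⟨
    neg (inv Z · inv Y · ((Z ⊖ Y) · inv X))
      ≡⟨ cong neg (·-assoc (inv Z · inv Y) (Z ⊖ Y) (inv X)) ⟨
    neg (inv Z · inv Y · (Z ⊖ Y) · inv X)
      ≡⟨ cong (λ M → neg (M · inv X)) (·-distribˡ-⊖ (inv Z · inv Y) Z Y) ⟩
    neg ((inv Z · inv Y · Z ⊖ inv Z · inv Y · Y) · inv X)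
      ≡⟨ cong (λ M → neg ((inv Z · inv Y · Z ⊖ M) · inv X)) (B·C≡I⇒A·B·C≡A (inv Z) (inv Y) Y (·-inverseˡ Y detY≡1)) ⟩
    neg ((inv Z · inv Y · Z ⊖ inv Z) · inv X)
      ≡⟨ cong neg (·-distribʳ-⊖ (inv Z · inv Y · Z) (inv Z) (inv X)) ⟩
    neg (inv Z · inv Y · Z · inv X ⊖ inv Z · inv X)
      ∎

MM-[Q⊖P]·R⊕Q : ∀ P Q R X Y Z → IsMMDecomposition P Q R X Y Z →
  (Q ⊖ P) · R ⊕ Q ≡ neg (inv Z · (X · (inv Y · inv X)))
MM-[Q⊖P]·R⊕Q P Q R X Y Z (_ , detY≡1 , _ , refl , refl , refl , trX≡trY , _) = begin
  (Q ⊖ P) · R ⊕ Q                                           ≡⟨ cong (λ M → M · R ⊕ Q) Q⊖P≡ ⟩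
  inv Z · (X ⊖ Y) · R ⊕ Q                                   ≡⟨ cong (_⊕ Q) Z⁻¹·[X⊖Y]·R≡ ⟩
  neg (inv Z · (X · (inv Y · inv X)) ⊖ inv Z · inv X) ⊕ Q   ≡⟨ neg-⊖-⊕-neg (inv Z · (X · (inv Y · inv X))) (inv Z · inv X) ⟩
  neg (inv Z · (X · (inv Y · inv X)))                       ∎
  where
  Q⊖P≡ : Q ⊖ P ≡ inv Z · (X ⊖ Y)
  Q⊖P≡ = begin
    neg (inv Z · inv X) ⊖ neg (inv Z · inv Y)  ≡⟨ neg-⊖-neg (inv Z · inv X) (inv Z · inv Y) ⟩
    inv Z · inv Y ⊖ inv Z · inv X              ≡⟨ ·-distribˡ-⊖ (inv Z) (inv Y) (inv X) ⟨
    inv Z · (inv Y ⊖ inv X)                    ≡⟨ cong (inv Z ·_) (inv-⊖-inv Y X (sym trX≡trY)) ⟩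
    inv Z · (X ⊖ Y)                            ∎

  Z⁻¹·[X⊖Y]·R≡ : inv Z · (X ⊖ Y) · R ≡ neg (inv Z · (X · (inv Y · inv X)) ⊖ inv Z · inv X)
  Z⁻¹·[X⊖Y]·R≡ = begin
    inv Z · (X ⊖ Y) · neg (inv Y · inv X)
      ≡⟨ neg-distribʳ-· (inv Z · (X ⊖ Y)) (inv Y · inv X) ⟨
    neg (inv Z · (X ⊖ Y) · (inv Y · inv X))
      ≡⟨ cong neg (·-assoc (inv Z) (X ⊖ Y) (inv Y · inv X)) ⟩
    neg (inv Z · ((X ⊖ Y) · (inv Y · inv X)))
      ≡⟨ cong (λ M → neg (inv Z · M)) (·-distribʳ-⊖ X Y (inv Y · inv X)) ⟩
    neg (inv Z · (X · (inv Y · inv X) ⊖ Y · (inv Y · inv X)))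
      ≡⟨ cong (λ M → neg (inv Z · (X · (inv Y · inv X) ⊖ M))) (A·B≡I⇒A·[B·C]≡C Y (inv Y) (inv X) (·-inverseʳ Y detY≡1)) ⟩
    neg (inv Z · (X · (inv Y · inv X) ⊖ inv X))
      ≡⟨ cong neg (·-distribˡ-⊖ (inv Z) (X · (inv Y · inv X)) (inv X)) ⟩
    neg (inv Z · (X · (inv Y · inv X)) ⊖ inv Z · inv X)
      ∎

MM-mutationˡ : ∀ P Q R S X Y Z → IsMMDecomposition P Q R X Y Z → Q ≡ P · R ⊖ S →
  IsMMDecomposition P (P · Q ⊖ S) Q X Z (inv Z · Y · Z)
MM-mutationˡ P Q R S X Y Z mm@(detX≡1 , detY≡1 , detZ≡1 , refl , refl , refl , trX≡trY , trY≡trZ) Q≡PR⊖S =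
  detX≡1 , detZ≡1 , IsSL2-· (inv Z · Y) Z (IsSL2-· (inv Z) Y (IsSL2-inv Z detZ≡1) detY≡1) detZ≡1 ,
  cong neg (sym Z⁻¹Y⁻¹≡) , PQ⊖S≡ , refl ,
  trans trX≡trY trY≡trZ , sym (trans (tr-conjugate Z Y detZ≡1) trY≡trZ)
  where
  Z⁻¹Y⁻¹≡ : inv (inv Z · Y · Z) · inv Z ≡ inv Z · inv Y
  Z⁻¹Y⁻¹≡ = begin
    inv (inv Z · Y · Z) · inv Z  ≡⟨ cong (_· inv Z) (inv-conjugate Z Y) ⟩
    inv Z · inv Y · Z · inv Z    ≡⟨ B·C≡I⇒A·B·C≡A (inv Z · inv Y) Z (inv Z) (·-inverseʳ Z detZ≡1) ⟩
    inv Z · inv Y                ∎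

  PQ⊖S≡ : P · Q ⊖ S ≡ neg (inv (inv Z · Y · Z) · inv X)
  PQ⊖S≡ = begin
    P · Q ⊖ S                          ≡⟨ P·Q⊖S≡P·[Q⊖R]⊕Q P Q R S Q≡PR⊖S ⟩
    P · (Q ⊖ R) ⊕ Q                    ≡⟨ MM-P·[Q⊖R]⊕Q P Q R X Y Z mm ⟩
    neg (inv Z · inv Y · Z · inv X)    ≡⟨ cong (λ M → neg (M · inv X)) (inv-conjugate Z Y) ⟨
    neg (inv (inv Z · Y · Z) · inv X)  ∎

MM-mutationʳ : ∀ P Q R S X Y Z → IsMMDecomposition P Q R X Y Z → Q ≡ P · R ⊖ S →
  IsMMDecomposition Q (Q · R ⊖ S) R (X · Y · inv X) X Z
MM-mutationʳ P Q R S X Y Z mm@(detX≡1 , detY≡1 , detZ≡1 , refl , refl , refl , trX≡trY , trY≡trZ) Q≡PR⊖S =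
  IsSL2-· (X · Y) (inv X) (IsSL2-· X Y detX≡1 detY≡1) (IsSL2-inv X detX≡1) , detX≡1 , detZ≡1 ,
  refl , QR⊖S≡ , cong neg (sym Y⁻¹X⁻¹≡) ,
  trans (tr-conjugate′ X Y detX≡1) (sym trX≡trY) , trans trX≡trY trY≡trZ
  where
  Y⁻¹X⁻¹≡ : inv X · inv (X · Y · inv X) ≡ inv Y · inv X
  Y⁻¹X⁻¹≡ = begin
    inv X · inv (X · Y · inv X)    ≡⟨ cong (inv X ·_) (inv-conjugate′ X Y) ⟩
    inv X · (X · (inv Y · inv X))  ≡⟨ A·B≡I⇒A·[B·C]≡C (inv X) X (inv Y · inv X) (·-inverseˡ X detX≡1) ⟩
    inv Y · inv X                  ∎

  QR⊖S≡ : Q · R ⊖ S ≡ neg (inv Z · inv (X · Y · inv X))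
  QR⊖S≡ = begin
    Q · R ⊖ S                            ≡⟨ Q·R⊖S≡[Q⊖P]·R⊕Q P Q R S Q≡PR⊖S ⟩
    (Q ⊖ P) · R ⊕ Q                      ≡⟨ MM-[Q⊖P]·R⊕Q P Q R X Y Z mm ⟩
    neg (inv Z · (X · (inv Y · inv X)))  ≡⟨ cong (λ M → neg (inv Z · M)) (inv-conjugate′ X Y) ⟨
    neg (inv Z · inv (X · Y · inv X))    ∎

proposition5p23 : (k : ℕ) (P Q R X Y Z : M2) →
    IsGCTriple k P Q R → IsMMDecomposition P Q R X Y Z →
    IsMMDecomposition P (P · Q ⊖ Smat k) Q X Z (inv Z · Y · Z)
    × IsMMDecomposition Q (Q · R ⊖ Smat k) R (X · Y · inv X) X Z
proposition5p23 k P Q R X Y Z (_ , _ , _ , Q≡PR⊖S , _) mm =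
  MM-mutationˡ P Q R (Smat k) X Y Z mm Q≡PR⊖S , MM-mutationʳ P Q R (Smat k) X Y Z mm Q≡PR⊖S
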